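{- Let $M$ be a $\mathrm{GF}(4)$-representable matroid with a circuit-hyperplane $H$. If $M$ is not connected, then $M\cong U_{1,m}\oplus U_{n-1,n}$ for some positive integers $m$ and $n$. -}

module Defs where

open import Level using (0ℓ)
open import Data.Bool using (Bool; true; false; _xor_; _∧_)
open import Data.Nat using (ℕ; zero; suc; _≤_; _<_; _∸_)
open import Data.Fin using (Fin)
open import Data.Fin.Subset using (Subset; _∈_; _∉_; _⊆_; _⊂_; _∪_; ⁅_⁆; ∣_∣) renaming (⊥ to ∅)
open import Data.Vec using (Vec; take; drop; tabulate; lookup)
open import Data.Product using (_×_; Σ; ∃; ∃-syntax; _,_)
open import Relation.Nullary using (¬_)
open import Relation.Binary.PropositionalEquality using (_≡_; _≢_)
open import Function.Bundles using (_⤖_; _⇔_; Bijection)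

record Matroid (N : ℕ) : Set₁ where
  field
    Indep   : Subset N → Set
    indep-∅ : Indep ∅
    indep-⊆ : ∀ {X Y} → Indep Y → X ⊆ Y → Indep X
    augment : ∀ {X Y} → Indep X → Indep Y → ∣ X ∣ < ∣ Y ∣ →
              ∃[ e ] (e ∈ Y × e ∉ X × Indep (X ∪ ⁅ e ⁆))

module _ {N : ℕ} (M : Matroid N) where
  open Matroid M

  IsCircuit : Subset N → Set
  IsCircuit C = ¬ Indep C × (∀ X → X ⊂ C → Indep X)

  IsBasis : Subset N → Set
  IsBasis B = Indep B × (∀ X → B ⊂ X → ¬ Indep X)

  Spanning : Subset N → Set
  Spanning X = ∃[ B ] (B ⊆ X × IsBasis B)

  IsHyperplane : Subset N → Set
  IsHyperplane H = ¬ Spanning H × (∀ X → H ⊂ X → Spanning X)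

  IsCircuitHyperplane : Subset N → Set
  IsCircuitHyperplane H = IsCircuit H × IsHyperplane H

  Connected : Set
  Connected = ∀ (e f : Fin N) → e ≢ f → ∃[ C ] (IsCircuit C × e ∈ C × f ∈ C)

-- GF(4) = GF(2)[ω]/(ω² + ω + 1); the pair (a , b) stands for a + bω.

GF4 : Set
GF4 = Bool × Bool

0# : GF4
0# = false , false

_+₄_ : GF4 → GF4 → GF4
(a , b) +₄ (c , d) = (a xor c) , (b xor d)

-- (a + bω)(c + dω) = (ac + bd) + (ad + bc + bd)ω
_*₄_ : GF4 → GF4 → GF4
(a , b) *₄ (c , d) = ((a ∧ c) xor (b ∧ d)) , (((a ∧ d) xor (b ∧ c)) xor (b ∧ d))

sum₄ : ∀ {N} → (Fin N → GF4) → GF4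
sum₄ {zero}  f = 0#
sum₄ {suc N} f = f Fin.zero +₄ sum₄ (λ i → f (Fin.suc i))

LinIndep₄ : ∀ {N r} → (Fin N → Fin r → GF4) → Subset N → Set
LinIndep₄ {N} {r} A X =
  ∀ (c : Fin N → GF4) →
    (∀ i → c i ≢ 0# → i ∈ X) →
    (∀ j → sum₄ (λ i → c i *₄ A i j) ≡ 0#) →
    ∀ i → c i ≡ 0#

GF4-Representable : ∀ {N} → Matroid N → Set
GF4-Representable {N} M =
  ∃[ r ] Σ (Fin N → Fin r → GF4) λ A →
    ∀ X → (Matroid.Indep M X ⇔ LinIndep₄ A X)

UniformIndep : (r k : ℕ) → Subset k → Set
UniformIndep r k X = ∣ X ∣ ≤ r

DirectSumIndep : ∀ {a b} → (Subset a → Set) → (Subset b → Set) →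
                 Subset (a Data.Nat.+ b) → Set
DirectSumIndep {a} I J X = I (take a X) × J (drop a X)

_≅_ : ∀ {N K} → Matroid N → (Subset K → Set) → Set
_≅_ {N} {K} M J =
  Σ (Fin N ⤖ Fin K) λ σ →
    ∀ (X : Subset K) →
      (J X ⇔ Matroid.Indep M (tabulate (λ i → lookup X (Bijection.to σ i))))

module Submission where

-- H is a circuit and a hyperplane, so M has rank |H| and (H - x) ∪ {d} is a basis
-- whenever x ∈ H and d ∉ H.  Two elements of H lie on the circuit H, and two
-- elements outside H lie on a circuit inside (H - x) ∪ {d, d′}.  If some two
-- elements outside H were independent, augmenting them to size |H| would also put
-- every element of H on a circuit with every element outside H, making M
-- connected.  Hence in a disconnected M the elements outside H are pairwise
-- parallel, and a set is independent exactly when it misses an element of H and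
-- has at most one element outside H: this is U(1,m) ⊕ U(n-1,n) on (E - H) ⊕ H.
-- Representability over GF(4) is used only to make independence decidable, which
-- the case analyses of the constructive proof require.

open import Defs
open import Data.Bool using (Bool; true; false)
import Data.Bool.Properties as Bool
open import Data.Empty using (⊥-elim)
open import Data.Fin using (Fin; _↑ˡ_; _↑ʳ_; join; _≟_)
open import Data.Fin.Properties using (all?; any?; +↔⊎)
open import Data.Fin.Subset
  using (Subset; _∈_; _∉_; _⊆_; _⊂_; _⊃_; _∪_; _∩_; _─_; _-_; ∁; ⁅_⁆; ∣_∣; ⊤; Nonempty;
         inside; outside)
  renaming (⊥ to ∅)
open import Data.Fin.Subset.Induction using (⊂-wellFounded; ⊃-wellFounded)
open import Data.Fin.Subset.Properties
open import Data.Nat using (ℕ; zero; suc; _+_; _∸_; _≤_; _<_; _≥_; _≤?_; z≤n; s≤s; s≤s⁻¹)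
open import Data.Nat.Properties
  using (≤-trans; ≤-reflexive; <⇒≱; ≮⇒≥; ≰⇒>; m∸n≡0⇒m≤n; module ≤-Reasoning)
open import Data.Product using (∃-syntax; _×_; _,_; proj₁; proj₂)
open import Data.Product.Function.NonDependent.Propositional using (_×-⇔_)
open import Data.Product.Properties using (≡-dec)
open import Data.Sum using (_⊎_; inj₁; inj₂)
import Data.Sum as Sum
open import Data.Sum.Properties using (inj₁-injective)
open import Data.Vec using (_∷_; here; there; lookup; tabulate; take; drop)
open import Data.Vec.Functional as Vector using (Vector; head; tail)
open import Data.Vec.Properties using ([]=⇒lookup; lookup⇒[]=; lookup∘tabulate)
open import Function using (_∘_)
open import Function.Bundles using (_⇔_; mk⇔; Equivalence; _↔_; mk↔ₛ′; Inverse)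
open Equivalence using (to; from)
open import Function.Construct.Composition using (_↔-∘_; _⇔-∘_)
open import Function.Construct.Symmetry using (↔-sym; ⇔-sym)
open import Function.Properties.Inverse using (↔⇒⤖)
open import Induction.WellFounded using (Acc; acc)
open import Relation.Binary.PropositionalEquality
  using (_≡_; _≢_; _≗_; refl; sym; trans; cong; cong₂; subst)
open import Relation.Nullary using (¬_; Dec; yes; no; ¬?)
open import Relation.Nullary.Decidable using (map′; _→-dec_; _×-dec_; decidable-stable)

Exhaustible : Set → Set₁
Exhaustible A = ∀ {P : A → Set} → (∀ a → Dec (P a)) → Dec (∀ a → P a)

Bool-exhaustible : Exhaustible Bool
Bool-exhaustible P? = map′ (λ (f , t) → λ { false → f ; true → t }) (λ h → h false , h true)
                           (P? false ×-dec P? true)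

×-exhaustible : ∀ {A B} → Exhaustible A → Exhaustible B → Exhaustible (A × B)
×-exhaustible A-ex B-ex P? = map′ (λ h (a , b) → h a b) (λ h a b → h (a , b))
                                  (A-ex λ a → B-ex λ b → P? (a , b))

-- Without function extensionality only predicates that respect pointwise
-- equality can be decided by enumerating functions.
Vector-exhaustible : ∀ {A} → Exhaustible A → ∀ n {P : Vector A n → Set} →
                     (∀ {f g} → f ≗ g → P f → P g) →
                     (∀ f → Dec (P f)) → Dec (∀ f → P f)
Vector-exhaustible A-ex zero    resp P? =
  map′ (λ p f → resp (λ ()) p) (λ h → h _) (P? (λ ()))
Vector-exhaustible A-ex (suc n) resp P? =
  map′ (λ h f → resp (λ { Fin.zero → refl ; (Fin.suc i) → refl }) (h (tail f) (head f)))
       (λ h t a → h (a Vector.∷ t))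
       (Vector-exhaustible A-ex n
          (λ t≗t′ p a → resp (λ { Fin.zero → refl ; (Fin.suc i) → t≗t′ i }) (p a))
          (λ t → A-ex λ a → P? (a Vector.∷ t)))

_≟₄_ : (a b : GF4) → Dec (a ≡ b)
_≟₄_ = ≡-dec Bool._≟_ Bool._≟_

sum₄-cong : ∀ {n} {f g : Fin n → GF4} → f ≗ g → sum₄ f ≡ sum₄ g
sum₄-cong {zero}  f≗g = refl
sum₄-cong {suc n} f≗g = cong₂ _+₄_ (f≗g Fin.zero) (sum₄-cong (f≗g ∘ Fin.suc))

LinIndep₄? : ∀ {N r} (A : Fin N → Fin r → GF4) X → Dec (LinIndep₄ A X)
LinIndep₄? {N} A X =
  Vector-exhaustible (×-exhaustible Bool-exhaustible Bool-exhaustible) N resp λ c →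
  all? (λ i → ¬? (c i ≟₄ 0#) →-dec (i ∈? X)) →-dec
  all? (λ j → sum₄ (λ i → c i *₄ A i j) ≟₄ 0#) →-dec
  all? (λ i → c i ≟₄ 0#)
  where
  resp : ∀ {c c′} → c ≗ c′ → _ → _
  resp c≗c′ indep supp rel i = trans (sym (c≗c′ i)) (indep
    (λ i c≢0 → supp i (c≢0 ∘ trans (c≗c′ i)))
    (λ j → trans (sum₄-cong λ i → cong (_*₄ A i j) (c≗c′ i)) (rel j)) i)

representable⇒indep? : ∀ {N} (M : Matroid N) → GF4-Representable M → ∀ X → Dec (Matroid.Indep M X)
representable⇒indep? M (_ , A , rep) X =
  map′ (from (rep X)) (to (rep X)) (LinIndep₄? A X)

x∈p─q⇒x∉q : ∀ {n} (p q : Subset n) {x} → x ∈ p ─ q → x ∉ q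
x∈p─q⇒x∉q (s ∷ p)      (inside  ∷ q) (there x∈) (there x∈q) = x∈p─q⇒x∉q p q x∈ x∈q
x∈p─q⇒x∉q (s ∷ p)      (outside ∷ q) (there x∈) (there x∈q) = x∈p─q⇒x∉q p q x∈ x∈q
x∈p─q⇒x∉q (inside ∷ p) (outside ∷ q) here ()

module _ {n : ℕ} where

  x∈p-y⁻ : ∀ {p : Subset n} {x y} → x ∈ p - y → x ∈ p × x ≢ y
  x∈p-y⁻ {p} {x} {y} x∈ = p─q⊆p p ⁅ y ⁆ x∈ , x∉⁅y⁆⇒x≢y (x∈p─q⇒x∉q p ⁅ y ⁆ x∈)

  x∈p∪⁅y⁆⁻ : ∀ {p : Subset n} {x y} → x ∈ p ∪ ⁅ y ⁆ → x ∈ p ⊎ x ≡ y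
  x∈p∪⁅y⁆⁻ {p} {y = y} x∈ with x∈p∪q⁻ p ⁅ y ⁆ x∈
  ... | inj₁ x∈p = inj₁ x∈p
  ... | inj₂ x∈y = inj₂ (x∈⁅y⁆⇒x≡y y x∈y)

  x∈p∪⁅y⁆∧x≢y⇒x∈p : ∀ {p : Subset n} {x y} → x ∈ p ∪ ⁅ y ⁆ → x ≢ y → x ∈ p
  x∈p∪⁅y⁆∧x≢y⇒x∈p x∈ x≢y with x∈p∪⁅y⁆⁻ x∈
  ... | inj₁ x∈p = x∈p
  ... | inj₂ x≡y = ⊥-elim (x≢y x≡y)

  x∈p∧x∉p-y⇒x≡y : ∀ {p : Subset n} {x y} → x ∈ p → x ∉ p - y → x ≡ y
  x∈p∧x∉p-y⇒x≡y {x = x} {y} x∈p x∉ = decidable-stable (x ≟ y) (x∉ ∘ x∈p∧x≢y⇒x∈p-y x∈p)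

  x∈p⇒⁅x⁆⊆p : ∀ {p : Subset n} {x} → x ∈ p → ⁅ x ⁆ ⊆ p
  x∈p⇒⁅x⁆⊆p {x = x} x∈p y∈ = subst (_∈ _) (sym (x∈⁅y⁆⇒x≡y x y∈)) x∈p

  ∪-least : ∀ {p q r : Subset n} → p ⊆ r → q ⊆ r → p ∪ q ⊆ r
  ∪-least {p} {q} p⊆r q⊆r x∈ with x∈p∪q⁻ p q x∈
  ... | inj₁ x∈p = p⊆r x∈p
  ... | inj₂ x∈q = q⊆r x∈q

  ∪⁅⁆-swap : ∀ {p : Subset n} {x y} → (p ∪ ⁅ x ⁆) ∪ ⁅ y ⁆ ≡ (p ∪ ⁅ y ⁆) ∪ ⁅ x ⁆
  ∪⁅⁆-swap {p} {x} {y} = trans (∪-assoc p ⁅ x ⁆ ⁅ y ⁆)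
                        (trans (cong (p ∪_) (∪-comm ⁅ x ⁆ ⁅ y ⁆)) (sym (∪-assoc p ⁅ y ⁆ ⁅ x ⁆)))

  x∈p∪⁅x⁆ : ∀ {p : Subset n} {x} → x ∈ p ∪ ⁅ x ⁆
  x∈p∪⁅x⁆ {p} {x} = q⊆p∪q p ⁅ x ⁆ (x∈⁅x⁆ x)

  x∉p⇒p⊂p∪⁅x⁆ : ∀ {p : Subset n} {x} → x ∉ p → p ⊂ p ∪ ⁅ x ⁆
  x∉p⇒p⊂p∪⁅x⁆ {x = x} x∉p = p⊆p∪q ⁅ x ⁆ , x , x∈p∪⁅x⁆ , x∉p

  p⊆p-x∪⁅x⁆ : ∀ {p : Subset n} {x} → p ⊆ (p - x) ∪ ⁅ x ⁆
  p⊆p-x∪⁅x⁆ {p} {x} {y} y∈p with y ≟ x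
  ... | yes refl = x∈p∪⁅x⁆
  ... | no y≢x   = p⊆p∪q ⁅ x ⁆ (x∈p∧x≢y⇒x∈p-y y∈p y≢x)

  ⊆-or-∃∉ : ∀ (p q : Subset n) → p ⊆ q ⊎ ∃[ x ] (x ∈ p × x ∉ q)
  ⊆-or-∃∉ p q with any? (λ x → (x ∈? p) ×-dec ¬? (x ∈? q))
  ... | yes witness = inj₂ witness
  ... | no none     = inj₁ λ {x} x∈p → decidable-stable (x ∈? q) (λ x∉q → none (x , x∈p , x∉q))

∣p∪⁅x⁆∣≡1+∣p∣ : ∀ {n} {p : Subset n} {x} → x ∉ p → ∣ p ∪ ⁅ x ⁆ ∣ ≡ suc ∣ p ∣
∣p∪⁅x⁆∣≡1+∣p∣ {p = inside  ∷ p} {Fin.zero}  x∉p = ⊥-elim (x∉p here)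
∣p∪⁅x⁆∣≡1+∣p∣ {p = outside ∷ p} {Fin.zero}  x∉p = cong (suc ∘ ∣_∣) (∪-identityʳ p)
∣p∪⁅x⁆∣≡1+∣p∣ {p = inside  ∷ p} {Fin.suc x} x∉p = cong suc (∣p∪⁅x⁆∣≡1+∣p∣ (x∉p ∘ there))
∣p∪⁅x⁆∣≡1+∣p∣ {p = outside ∷ p} {Fin.suc x} x∉p = ∣p∪⁅x⁆∣≡1+∣p∣ (x∉p ∘ there)

1+∣p-x∣≡∣p∣ : ∀ {n} {p : Subset n} {x} → x ∈ p → suc ∣ p - x ∣ ≡ ∣ p ∣
1+∣p-x∣≡∣p∣ {p = inside  ∷ p} {Fin.zero}  _         = cong (suc ∘ ∣_∣) (p─⊥≡p p)
1+∣p-x∣≡∣p∣ {p = inside  ∷ p} {Fin.suc x} (there x∈) = cong suc (1+∣p-x∣≡∣p∣ x∈)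
1+∣p-x∣≡∣p∣ {p = outside ∷ p} {Fin.suc x} (there x∈) = 1+∣p-x∣≡∣p∣ x∈

∣⁅x⁆∣<∣⁅y⁆∪⁅z⁆∣ : ∀ {n} {x y z : Fin n} → y ≢ z → ∣ ⁅ x ⁆ ∣ < ∣ ⁅ y ⁆ ∪ ⁅ z ⁆ ∣
∣⁅x⁆∣<∣⁅y⁆∪⁅z⁆∣ {x = x} {y} {z} y≢z = begin-strict
  ∣ ⁅ x ⁆ ∣         ≡⟨ trans (∣⁅x⁆∣≡1 x) (sym (∣⁅x⁆∣≡1 y)) ⟩
  ∣ ⁅ y ⁆ ∣         <⟨ p⊂q⇒∣p∣<∣q∣ (x∉p⇒p⊂p∪⁅x⁆ (x≢y⇒x∉⁅y⁆ (y≢z ∘ sym))) ⟩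
  ∣ ⁅ y ⁆ ∪ ⁅ z ⁆ ∣ ∎
  where open ≤-Reasoning

Subsingleton : ∀ {n} → Subset n → Set
Subsingleton p = ∀ {x y} → x ∈ p → y ∈ p → x ≡ y

∣p∣≤1⇔subsingleton : ∀ {n} {p : Subset n} → ∣ p ∣ ≤ 1 ⇔ Subsingleton p
∣p∣≤1⇔subsingleton {n} {p} = mk⇔ ≤1⇒subsingleton subsingleton⇒≤1
  where
  ≤1⇒subsingleton : ∣ p ∣ ≤ 1 → Subsingleton p
  ≤1⇒subsingleton ∣p∣≤1 {x} {y} x∈p y∈p = decidable-stable (x ≟ y) λ x≢y →
    <⇒≱ (≤-trans (∣⁅x⁆∣<∣⁅y⁆∪⁅z⁆∣ {x = x} x≢y)
                 (p⊆q⇒∣p∣≤∣q∣ (∪-least (x∈p⇒⁅x⁆⊆p x∈p) (x∈p⇒⁅x⁆⊆p y∈p))))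
        (subst (∣ p ∣ ≤_) (sym (∣⁅x⁆∣≡1 x)) ∣p∣≤1)
  subsingleton⇒≤1 : Subsingleton p → ∣ p ∣ ≤ 1
  subsingleton⇒≤1 single with nonempty? p
  ... | yes (x , x∈p) = ≤-trans (p⊆q⇒∣p∣≤∣q∣ λ y∈p → subst (_∈ ⁅ x ⁆) (single x∈p y∈p) (x∈⁅x⁆ x))
                                (≤-reflexive (∣⁅x⁆∣≡1 x))
  ... | no empty      = ≤-trans (p⊆q⇒∣p∣≤∣q∣ {q = ∅} λ y∈p → ⊥-elim (empty (_ , y∈p)))
                                (≤-trans (≤-reflexive (∣⊥∣≡0 n)) z≤n)

∣p∣≤n∸1⇔∃∉ : ∀ {n} {p : Subset n} → 1 ≤ n → ∣ p ∣ ≤ n ∸ 1 ⇔ (∃[ x ] x ∉ p)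
∣p∣≤n∸1⇔∃∉ {suc n} {p} _ = mk⇔ small⇒∃∉ λ (x , x∉p) →
  s≤s⁻¹ (≤-trans (p⊂q⇒∣p∣<∣q∣ (⊆⊤ , x , ∈⊤ , x∉p)) (≤-reflexive (∣⊤∣≡n (suc n))))
  where
  small⇒∃∉ : ∣ p ∣ ≤ n → ∃[ x ] x ∉ p
  small⇒∃∉ ∣p∣≤n with nonempty? (∁ p)
  ... | yes (x , x∈∁p) = x , x∈∁p⇒x∉p x∈∁p
  ... | no empty = ⊥-elim (<⇒≱ (s≤s ∣p∣≤n) (m∸n≡0⇒m≤n (begin-equality
      suc n ∸ ∣ p ∣ ≡⟨ sym (∣∁p∣≡n∸∣p∣ p) ⟩
      ∣ ∁ p ∣       ≡⟨ cong ∣_∣ (Empty-unique empty) ⟩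
      ∣ ∅ {suc n} ∣ ≡⟨ ∣⊥∣≡0 (suc n) ⟩
      0             ∎)))
    where open ≤-Reasoning

module MatroidProperties {N : ℕ} (M : Matroid N) where
  open Matroid M

  basis-maximum : ∀ {B I} → IsBasis M B → Indep I → ∣ I ∣ ≤ ∣ B ∣
  basis-maximum (indB , maximal) indI = ≮⇒≥ λ ∣B∣<∣I∣ →
    let (z , _ , z∉B , indBz) = augment indB indI ∣B∣<∣I∣
    in maximal _ (x∉p⇒p⊂p∪⁅x⁆ z∉B) indBz

  augment-to : ∀ {I J} → Indep I → Indep J →
               ∃[ K ] (I ⊆ K × K ⊆ I ∪ J × Indep K × ∣ J ∣ ≤ ∣ K ∣)
  augment-to {I} {J} = grow I (⊃-wellFounded I)
    where
    grow : ∀ I → Acc _⊃_ I → Indep I → Indep J →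
           ∃[ K ] (I ⊆ K × K ⊆ I ∪ J × Indep K × ∣ J ∣ ≤ ∣ K ∣)
    grow I (acc rec) indI indJ with ∣ J ∣ ≤? ∣ I ∣
    ... | yes ∣J∣≤∣I∣ = I , (λ x∈ → x∈) , p⊆p∪q J , indI , ∣J∣≤∣I∣
    ... | no ∣J∣≰∣I∣
      with e , e∈J , e∉I , indIe ← augment indI indJ (≰⇒> ∣J∣≰∣I∣)
      with K , I∪e⊆K , K⊆ , indK , ∣J∣≤∣K∣ ← grow (I ∪ ⁅ e ⁆) (rec (x∉p⇒p⊂p∪⁅x⁆ e∉I)) indIe indJ
      = K , I∪e⊆K ∘ p⊆p∪q ⁅ e ⁆ ,
        ∪-least (∪-least (p⊆p∪q J) (x∈p⇒⁅x⁆⊆p (q⊆p∪q I J e∈J))) (q⊆p∪q I J) ∘ K⊆ ,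
        indK , ∣J∣≤∣K∣

  C⊆I∪⁅x⁆⇒x∈C : ∀ {C I x} → IsCircuit M C → Indep I → C ⊆ I ∪ ⁅ x ⁆ → x ∈ C
  C⊆I∪⁅x⁆⇒x∈C {C} {x = x} (dep , _) indI C⊆ = decidable-stable (x ∈? C) λ x∉C →
    dep (indep-⊆ indI λ y∈C → x∈p∪⁅y⁆∧x≢y⇒x∈p (C⊆ y∈C) λ { refl → x∉C y∈C })

  module WithDecidableIndep (indep? : ∀ X → Dec (Indep X)) where

    extend-or-basis : ∀ {I} → Indep I → IsBasis M I ⊎ ∃[ e ] (e ∉ I × Indep (I ∪ ⁅ e ⁆))
    extend-or-basis {I} indI with any? (λ e → ¬? (e ∈? I) ×-dec indep? (I ∪ ⁅ e ⁆))
    ... | yes extension = inj₂ extension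
    ... | no none = inj₁ (indI , λ { X (I⊆X , x , x∈X , x∉I) indX →
            none (x , x∉I , indep-⊆ indX (∪-least I⊆X (x∈p⇒⁅x⁆⊆p x∈X))) })

    dependent⇒⊇circuit : ∀ S → ¬ Indep S → ∃[ C ] (C ⊆ S × IsCircuit M C)
    dependent⇒⊇circuit S = shrink S (⊂-wellFounded S)
      where
      shrink : ∀ S → Acc _⊂_ S → ¬ Indep S → ∃[ C ] (C ⊆ S × IsCircuit M C)
      shrink S (acc rec) depS with any? (λ x → (x ∈? S) ×-dec ¬? (indep? (S - x)))
      ... | yes (x , x∈S , depS-x) =
        let (C , C⊆ , circuit) = shrink (S - x) (rec (x∈p⇒p-x⊂p x∈S)) depS-x
        in C , p─q⊆p S ⁅ x ⁆ ∘ C⊆ , circuit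
      ... | no none = S , (λ x∈ → x∈) , depS , λ { X (X⊆S , x , x∈S , x∉X) →
            indep-⊆ (decidable-stable (indep? (S - x)) λ dep → none (x , x∈S , dep))
                    λ y∈X → x∈p∧x≢y⇒x∈p-y (X⊆S y∈X) λ { refl → x∉X y∈X } }

    module CircuitHyperplane {H : Subset N}
             (H-circuit : IsCircuit M H) (H-hyperplane : IsHyperplane M H) where

      H-dependent : ¬ Indep H
      H-dependent = proj₁ H-circuit

      H-x-indep : ∀ {x} → x ∈ H → Indep (H - x)
      H-x-indep x∈H = proj₂ H-circuit _ (x∈p⇒p-x⊂p x∈H)

      H-x-extends : ∀ {x} → x ∈ H → ∃[ e ] (e ∉ H - x × Indep ((H - x) ∪ ⁅ e ⁆))
      H-x-extends {x} x∈H with extend-or-basis (H-x-indep x∈H)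
      ... | inj₁ basis    = ⊥-elim (proj₁ H-hyperplane (H - x , p─q⊆p H ⁅ x ⁆ , basis))
      ... | inj₂ extends  = extends

      extension-∉H : ∀ {x e} → e ∉ H - x → Indep ((H - x) ∪ ⁅ e ⁆) → e ∉ H
      extension-∉H e∉H-x indep e∈H with refl ← x∈p∧x∉p-y⇒x≡y e∈H e∉H-x =
        H-dependent (indep-⊆ indep p⊆p-x∪⁅x⁆)

      H-nonempty : Nonempty H
      H-nonempty with nonempty? H
      ... | yes nonempty = nonempty
      ... | no empty     = ⊥-elim (H-dependent (indep-⊆ indep-∅ λ x∈H → ⊥-elim (empty (_ , x∈H))))

      ∃∉H : ∃[ d ] d ∉ H
      ∃∉H
        with _ , h∈H ← H-nonempty
        with e , e∉H-h , indep ← H-x-extends h∈H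
        = e , extension-∉H e∉H-h indep

      spanning-basis : ∀ {d} → d ∉ H → ∃[ B ] (B ⊆ H ∪ ⁅ d ⁆ × IsBasis M B)
      spanning-basis d∉H = proj₂ H-hyperplane _ (x∉p⇒p⊂p∪⁅x⁆ d∉H)

      ∣indep∣≤∣H∣ : ∀ {I} → Indep I → ∣ I ∣ ≤ ∣ H ∣
      ∣indep∣≤∣H∣ indI
        with d , d∉H ← ∃∉H
        with B , B⊆ , basis ← spanning-basis d∉H
        with ⊆-or-∃∉ H B
      ... | inj₁ H⊆B = ⊥-elim (H-dependent (indep-⊆ (proj₁ basis) H⊆B))
      ... | inj₂ (x , x∈H , x∉B) = ≤-trans (basis-maximum basis indI) (s≤s⁻¹ (begin
        suc ∣ B ∣       ≤⟨ p⊂q⇒∣p∣<∣q∣ (B⊆ , x , p⊆p∪q ⁅ d ⁆ x∈H , x∉B) ⟩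
        ∣ H ∪ ⁅ d ⁆ ∣   ≡⟨ ∣p∪⁅x⁆∣≡1+∣p∣ d∉H ⟩
        suc ∣ H ∣       ∎))
        where open ≤-Reasoning

      full-extension-dependent : ∀ {K y} → ∣ H ∣ ≤ ∣ K ∣ → y ∉ K → ¬ Indep (K ∪ ⁅ y ⁆)
      full-extension-dependent ∣H∣≤∣K∣ y∉K indK∪y = <⇒≱
        (≤-trans (s≤s ∣H∣≤∣K∣) (≤-reflexive (sym (∣p∪⁅x⁆∣≡1+∣p∣ y∉K)))) (∣indep∣≤∣H∣ indK∪y)

      ∣H-x∪⁅y⁆∣≡∣H∣ : ∀ {x y} → x ∈ H → y ∉ H → ∣ (H - x) ∪ ⁅ y ⁆ ∣ ≡ ∣ H ∣
      ∣H-x∪⁅y⁆∣≡∣H∣ x∈H y∉H = trans (∣p∪⁅x⁆∣≡1+∣p∣ (y∉H ∘ proj₁ ∘ x∈p-y⁻)) (1+∣p-x∣≡∣p∣ x∈H)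

      ∣H-x∣<∣basis∣ : ∀ {x B} → x ∈ H → IsBasis M B → ∣ H - x ∣ < ∣ B ∣
      ∣H-x∣<∣basis∣ x∈H basis with e , e∉H-x , indE ← H-x-extends x∈H =
        ≤-trans (≤-reflexive (sym (∣p∪⁅x⁆∣≡1+∣p∣ e∉H-x))) (basis-maximum basis indE)

      exchange : ∀ {x d} → x ∈ H → d ∉ H → Indep ((H - x) ∪ ⁅ d ⁆)
      exchange x∈H d∉H
        with B , B⊆ , basis ← spanning-basis d∉H
        with z , z∈B , z∉H-x , indZ ←
               augment (H-x-indep x∈H) (proj₁ basis) (∣H-x∣<∣basis∣ x∈H basis)
        with x∈p∪⁅y⁆⁻ (B⊆ z∈B)
      ... | inj₂ refl = indZ
      ... | inj₁ z∈H  = ⊥-elim (extension-∉H z∉H-x indZ z∈H)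

      ∉H-x∪⁅y⁆ : ∀ {x y z} → z ∉ H → z ≢ y → z ∉ (H - x) ∪ ⁅ y ⁆
      ∉H-x∪⁅y⁆ z∉H z≢y z∈ with x∈p∪⁅y⁆⁻ z∈
      ... | inj₁ z∈H-x = z∉H (proj₁ (x∈p-y⁻ z∈H-x))
      ... | inj₂ z≡y   = z≢y z≡y

      outside-pair-circuit : ∀ {e f} → e ∉ H → f ∉ H → e ≢ f →
                             ∃[ C ] (IsCircuit M C × e ∈ C × f ∈ C)
      outside-pair-circuit {e} {f} e∉H f∉H e≢f
        with h , h∈H ← H-nonempty
        with C , C⊆ , circuit ← dependent⇒⊇circuit _
               (full-extension-dependent (≤-reflexive (sym (∣H-x∪⁅y⁆∣≡∣H∣ h∈H e∉H)))
                                         (∉H-x∪⁅y⁆ f∉H (e≢f ∘ sym)))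
        = C , circuit , C⊆I∪⁅x⁆⇒x∈C circuit (exchange h∈H f∉H) (⊆-reflexive ∪⁅⁆-swap ∘ C⊆)
                      , C⊆I∪⁅x⁆⇒x∈C circuit (exchange h∈H e∉H) C⊆

      module _ {h d z} (h∈H : h ∈ H) (d∉H : d ∉ H) (z∉H : z ∉ H) (z≢d : z ≢ d) where

        private
          ∈augmentation-range⁻ : ∀ {y} → y ∈ (⁅ d ⁆ ∪ ⁅ z ⁆) ∪ ((H - h) ∪ ⁅ d ⁆) →
                                 y ∈ H - h ⊎ (y ≡ z ⊎ y ≡ d)
          ∈augmentation-range⁻ y∈ with x∈p∪q⁻ (⁅ d ⁆ ∪ ⁅ z ⁆) _ y∈
          ... | inj₂ y∈J with x∈p∪⁅y⁆⁻ y∈J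
          ...   | inj₁ y∈H-h = inj₁ y∈H-h
          ...   | inj₂ y≡d   = inj₂ (inj₂ y≡d)
          ∈augmentation-range⁻ y∈ | inj₁ y∈dz with x∈p∪⁅y⁆⁻ {p = ⁅ d ⁆} y∈dz
          ...   | inj₁ y∈d = inj₂ (inj₂ (x∈⁅y⁆⇒x≡y d y∈d))
          ...   | inj₂ y≡z = inj₂ (inj₁ y≡z)

          module _ {K} (K⊆ : K ⊆ (⁅ d ⁆ ∪ ⁅ z ⁆) ∪ ((H - h) ∪ ⁅ d ⁆)) where

            h∉K : h ∉ K
            h∉K h∈K with ∈augmentation-range⁻ (K⊆ h∈K)
            ... | inj₁ h∈H-h       = proj₂ (x∈p-y⁻ h∈H-h) refl
            ... | inj₂ (inj₁ refl) = z∉H h∈H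
            ... | inj₂ (inj₂ refl) = d∉H h∈H

            K∪⁅h⁆⊆ : ∀ {x} → x ∈ H - h → x ∉ K → K ∪ ⁅ h ⁆ ⊆ ((H - x) ∪ ⁅ z ⁆) ∪ ⁅ d ⁆
            K∪⁅h⁆⊆ {x} x∈H-h x∉K y∈ with x∈p∪⁅y⁆⁻ y∈
            ... | inj₂ refl =
              p⊆p∪q ⁅ d ⁆ (p⊆p∪q ⁅ z ⁆ (x∈p∧x≢y⇒x∈p-y h∈H (proj₂ (x∈p-y⁻ x∈H-h) ∘ sym)))
            ... | inj₁ y∈K with ∈augmentation-range⁻ (K⊆ y∈K)
            ...   | inj₁ y∈H-h       = p⊆p∪q ⁅ d ⁆ (p⊆p∪q ⁅ z ⁆
                                       (x∈p∧x≢y⇒x∈p-y (proj₁ (x∈p-y⁻ y∈H-h)) λ { refl → x∉K y∈K }))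
            ...   | inj₂ (inj₁ refl) = p⊆p∪q ⁅ d ⁆ x∈p∪⁅x⁆
            ...   | inj₂ (inj₂ refl) = x∈p∪⁅x⁆

        -- Augment {d, z} from the basis (H - h) ∪ {d} to an independent K with |K| = |H|.
        -- Then K ∪ {h} contains a circuit through h; as K misses some x ∈ H - h, that
        -- circuit lies in (H - x) ∪ {z, d} with (H - x) ∪ {z} independent, so it contains d.
        inside-outside-circuit : Indep (⁅ d ⁆ ∪ ⁅ z ⁆) → ∃[ C ] (IsCircuit M C × h ∈ C × d ∈ C)
        inside-outside-circuit indDZ
          with K , DZ⊆K , K⊆ , indK , ∣J∣≤∣K∣ ← augment-to indDZ (exchange h∈H d∉H)
          with ∣H∣≤∣K∣ ← ≤-trans (≤-reflexive (sym (∣H-x∪⁅y⁆∣≡∣H∣ h∈H d∉H))) ∣J∣≤∣K∣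
          with C , C⊆ , circuit ← dependent⇒⊇circuit _ (full-extension-dependent ∣H∣≤∣K∣ (h∉K K⊆))
          with ⊆-or-∃∉ (H - h) K
        ... | inj₁ H-h⊆K = ⊥-elim (full-extension-dependent
                (≤-reflexive (sym (∣H-x∪⁅y⁆∣≡∣H∣ h∈H d∉H))) (∉H-x∪⁅y⁆ z∉H z≢d)
                (indep-⊆ indK (∪-least (∪-least H-h⊆K (x∈p⇒⁅x⁆⊆p (DZ⊆K (p⊆p∪q ⁅ z ⁆ (x∈⁅x⁆ d)))))
                                       (x∈p⇒⁅x⁆⊆p (DZ⊆K x∈p∪⁅x⁆)))))
        ... | inj₂ (x , x∈H-h , x∉K) =
          C , circuit , C⊆I∪⁅x⁆⇒x∈C circuit indK C⊆
            , C⊆I∪⁅x⁆⇒x∈C circuit (exchange (proj₁ (x∈p-y⁻ x∈H-h)) z∉H) (K∪⁅h⁆⊆ K⊆ x∈H-h x∉K ∘ C⊆)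

      module _ {d₁ d₂} (d₁∉H : d₁ ∉ H) (d₂∉H : d₂ ∉ H) (d₁≢d₂ : d₁ ≢ d₂)
               (ind₁₂ : Indep (⁅ d₁ ⁆ ∪ ⁅ d₂ ⁆)) where

        ∈pair⇒∉H : ∀ {z} → z ∈ ⁅ d₁ ⁆ ∪ ⁅ d₂ ⁆ → z ∉ H
        ∈pair⇒∉H z∈ with x∈p∪⁅y⁆⁻ z∈
        ... | inj₁ z∈⁅d₁⁆ = subst (_∉ H) (sym (x∈⁅y⁆⇒x≡y d₁ z∈⁅d₁⁆)) d₁∉H
        ... | inj₂ refl   = d₂∉H

        mixed-pair-circuit : ∀ {h d} → h ∈ H → d ∉ H → ∃[ C ] (IsCircuit M C × h ∈ C × d ∈ C)
        mixed-pair-circuit {d = d} h∈H d∉H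
          with z , z∈₁₂ , z∉⁅d⁆ , indDZ ← augment (indep-⊆ (exchange h∈H d∉H) (x∈p⇒⁅x⁆⊆p x∈p∪⁅x⁆))
                                                  ind₁₂ (∣⁅x⁆∣<∣⁅y⁆∪⁅z⁆∣ {x = d} d₁≢d₂)
          = inside-outside-circuit h∈H d∉H (∈pair⇒∉H z∈₁₂) (x∉⁅y⁆⇒x≢y z∉⁅d⁆) indDZ

        independent-pair⇒connected : Connected M
        independent-pair⇒connected e f e≢f with e ∈? H | f ∈? H
        ... | yes e∈H | yes f∈H = H , H-circuit , e∈H , f∈H
        ... | no e∉H  | no f∉H  = outside-pair-circuit e∉H f∉H e≢f
        ... | yes e∈H | no f∉H  = mixed-pair-circuit e∈H f∉H
        ... | no e∉H  | yes f∈H = let (C , circuit , f∈C , e∈C) = mixed-pair-circuit f∈H e∉H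
                                  in C , circuit , e∈C , f∈C

      indep⇒misses-H : ∀ {Y} → Indep Y → ∃[ h ] (h ∈ H × h ∉ Y)
      indep⇒misses-H {Y} indY with ⊆-or-∃∉ H Y
      ... | inj₁ H⊆Y = ⊥-elim (H-dependent (indep-⊆ indY H⊆Y))
      ... | inj₂ miss = miss

      subsingleton-outside∧misses-H⇒indep : ∀ {Y h} → Subsingleton (Y ∩ ∁ H) → h ∈ H → h ∉ Y →
                                            Indep Y
      subsingleton-outside∧misses-H⇒indep {Y} {h} single h∈H h∉Y with any? (λ d → d ∈? (Y ∩ ∁ H))
      ... | yes (d , d∈) = indep-⊆ (exchange h∈H (x∈∁p⇒x∉p (proj₂ (x∈p∩q⁻ Y (∁ H) d∈)))) Y⊆H-h∪d
        where
        Y⊆H-h∪d : Y ⊆ (H - h) ∪ ⁅ d ⁆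
        Y⊆H-h∪d {y} y∈Y with y ∈? H
        ... | yes y∈H = p⊆p∪q ⁅ d ⁆ (x∈p∧x≢y⇒x∈p-y y∈H λ { refl → h∉Y y∈Y })
        ... | no y∉H  = subst (_∈ _) (sym (single (x∈p∩q⁺ (y∈Y , x∉p⇒x∈∁p y∉H)) d∈)) x∈p∪⁅x⁆
      ... | no none = indep-⊆ (H-x-indep h∈H) λ {y} y∈Y →
        x∈p∧x≢y⇒x∈p-y (decidable-stable (y ∈? H) λ y∉H → none (y , x∈p∩q⁺ (y∈Y , x∉p⇒x∈∁p y∉H)))
                      λ { refl → h∉Y y∈Y }

      module _ (disconnected : ¬ Connected M) where

        indep⇒subsingleton-outside : ∀ {Y} → Indep Y → Subsingleton (Y ∩ ∁ H)
        indep⇒subsingleton-outside {Y} indY {y₁} {y₂} y₁∈ y₂∈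
          with y₁∈Y , y₁∈∁H ← x∈p∩q⁻ Y (∁ H) y₁∈
          with y₂∈Y , y₂∈∁H ← x∈p∩q⁻ Y (∁ H) y₂∈
          = decidable-stable (y₁ ≟ y₂) λ y₁≢y₂ →
              disconnected (independent-pair⇒connected (x∈∁p⇒x∉p y₁∈∁H) (x∈∁p⇒x∉p y₂∈∁H) y₁≢y₂
                (indep-⊆ indY (∪-least (x∈p⇒⁅x⁆⊆p y₁∈Y) (x∈p⇒⁅x⁆⊆p y₂∈Y))))

        indep⇔ : ∀ {Y} → Indep Y ⇔ (Subsingleton (Y ∩ ∁ H) × ∃[ h ] (h ∈ H × h ∉ Y))
        indep⇔ = mk⇔ (λ indY → (λ {_} {_} → indep⇒subsingleton-outside indY) , indep⇒misses-H indY)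
                     λ (single , _ , h∈H , h∉Y) →
                       subsingleton-outside∧misses-H⇒indep single h∈H h∉Y

splitBy : ∀ {n} (p : Subset n) → Fin n → Fin ∣ ∁ p ∣ ⊎ Fin ∣ p ∣
splitBy (outside ∷ p) Fin.zero    = inj₁ Fin.zero
splitBy (inside  ∷ p) Fin.zero    = inj₂ Fin.zero
splitBy (outside ∷ p) (Fin.suc i) = Sum.map₁ Fin.suc (splitBy p i)
splitBy (inside  ∷ p) (Fin.suc i) = Sum.map₂ Fin.suc (splitBy p i)

joinBy : ∀ {n} (p : Subset n) → Fin ∣ ∁ p ∣ ⊎ Fin ∣ p ∣ → Fin n
joinBy (outside ∷ p) (inj₁ Fin.zero)    = Fin.zero
joinBy (outside ∷ p) (inj₁ (Fin.suc a)) = Fin.suc (joinBy p (inj₁ a))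
joinBy (outside ∷ p) (inj₂ b)           = Fin.suc (joinBy p (inj₂ b))
joinBy (inside  ∷ p) (inj₂ Fin.zero)    = Fin.zero
joinBy (inside  ∷ p) (inj₂ (Fin.suc b)) = Fin.suc (joinBy p (inj₂ b))
joinBy (inside  ∷ p) (inj₁ a)           = Fin.suc (joinBy p (inj₁ a))

joinBy-splitBy : ∀ {n} (p : Subset n) i → joinBy p (splitBy p i) ≡ i
joinBy-splitBy (outside ∷ p) Fin.zero = refl
joinBy-splitBy (inside  ∷ p) Fin.zero = refl
joinBy-splitBy (outside ∷ p) (Fin.suc i) with splitBy p i | joinBy-splitBy p i
... | inj₁ a | eq = cong Fin.suc eq
... | inj₂ b | eq = cong Fin.suc eq
joinBy-splitBy (inside  ∷ p) (Fin.suc i) with splitBy p i | joinBy-splitBy p i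
... | inj₁ a | eq = cong Fin.suc eq
... | inj₂ b | eq = cong Fin.suc eq

splitBy-joinBy : ∀ {n} (p : Subset n) s → splitBy p (joinBy p s) ≡ s
splitBy-joinBy (outside ∷ p) (inj₁ Fin.zero)    = refl
splitBy-joinBy (outside ∷ p) (inj₁ (Fin.suc a)) = cong (Sum.map₁ Fin.suc) (splitBy-joinBy p (inj₁ a))
splitBy-joinBy (outside ∷ p) (inj₂ b)           = cong (Sum.map₁ Fin.suc) (splitBy-joinBy p (inj₂ b))
splitBy-joinBy (inside  ∷ p) (inj₂ Fin.zero)    = refl
splitBy-joinBy (inside  ∷ p) (inj₂ (Fin.suc b)) = cong (Sum.map₂ Fin.suc) (splitBy-joinBy p (inj₂ b))
splitBy-joinBy (inside  ∷ p) (inj₁ a)           = cong (Sum.map₂ Fin.suc) (splitBy-joinBy p (inj₁ a))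

joinBy-inj₁-∉ : ∀ {n} (p : Subset n) a → joinBy p (inj₁ a) ∉ p
joinBy-inj₁-∉ (outside ∷ p) Fin.zero    ()
joinBy-inj₁-∉ (outside ∷ p) (Fin.suc a) (there x∈) = joinBy-inj₁-∉ p a x∈
joinBy-inj₁-∉ (inside  ∷ p) a           (there x∈) = joinBy-inj₁-∉ p a x∈

joinBy-inj₂-∈ : ∀ {n} (p : Subset n) b → joinBy p (inj₂ b) ∈ p
joinBy-inj₂-∈ (inside  ∷ p) Fin.zero    = here
joinBy-inj₂-∈ (inside  ∷ p) (Fin.suc b) = there (joinBy-inj₂-∈ p b)
joinBy-inj₂-∈ (outside ∷ p) b           = there (joinBy-inj₂-∈ p b)

∉⇒joinBy-inj₁ : ∀ {n} (p : Subset n) {x} → x ∉ p → ∃[ a ] joinBy p (inj₁ a) ≡ x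
∉⇒joinBy-inj₁ (outside ∷ p) {Fin.zero}  _   = Fin.zero , refl
∉⇒joinBy-inj₁ (inside  ∷ p) {Fin.zero}  x∉p = ⊥-elim (x∉p here)
∉⇒joinBy-inj₁ (outside ∷ p) {Fin.suc x} x∉p =
  let (a , eq) = ∉⇒joinBy-inj₁ p (x∉p ∘ there) in Fin.suc a , cong Fin.suc eq
∉⇒joinBy-inj₁ (inside  ∷ p) {Fin.suc x} x∉p =
  let (a , eq) = ∉⇒joinBy-inj₁ p (x∉p ∘ there) in a , cong Fin.suc eq

∈⇒joinBy-inj₂ : ∀ {n} (p : Subset n) {x} → x ∈ p → ∃[ b ] joinBy p (inj₂ b) ≡ x
∈⇒joinBy-inj₂ (inside  ∷ p) {Fin.zero}  _          = Fin.zero , refl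
∈⇒joinBy-inj₂ (outside ∷ p) {Fin.suc x} (there x∈) =
  let (b , eq) = ∈⇒joinBy-inj₂ p x∈ in b , cong Fin.suc eq
∈⇒joinBy-inj₂ (inside  ∷ p) {Fin.suc x} (there x∈) =
  let (b , eq) = ∈⇒joinBy-inj₂ p x∈ in Fin.suc b , cong Fin.suc eq

joinBy-injective : ∀ {n} (p : Subset n) {s t} → joinBy p s ≡ joinBy p t → s ≡ t
joinBy-injective p {s} {t} eq =
  trans (sym (splitBy-joinBy p s)) (trans (cong (splitBy p) eq) (splitBy-joinBy p t))

relabel : ∀ {n} (p : Subset n) → Fin n ↔ Fin (∣ ∁ p ∣ + ∣ p ∣)
relabel p = ↔-sym +↔⊎ ↔-∘ mk↔ₛ′ (splitBy p) (joinBy p) (splitBy-joinBy p) (joinBy-splitBy p)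

∈⇔lookup : ∀ {n} {p : Subset n} {i} → i ∈ p ⇔ lookup p i ≡ inside
∈⇔lookup {p = p} {i} = mk⇔ []=⇒lookup (lookup⇒[]= i p)

∈tabulate⇔ : ∀ {n} {f : Fin n → Bool} {i} → i ∈ tabulate f ⇔ f i ≡ inside
∈tabulate⇔ {f = f} {i} = mk⇔ (trans (sym (lookup∘tabulate f i)) ∘ []=⇒lookup)
                             (lookup⇒[]= i _ ∘ trans (lookup∘tabulate f i))

∈take⇔ : ∀ m {n} {X : Subset (m + n)} {i} → i ∈ take m X ⇔ i ↑ˡ n ∈ X
∈take⇔ (suc m) {X = x ∷ X} {Fin.zero}  = mk⇔ (λ { here → here }) (λ { here → here })
∈take⇔ (suc m) {X = x ∷ X} {Fin.suc i} = mk⇔ (λ { (there i∈) → there (to (∈take⇔ m) i∈) })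
                                              (λ { (there i∈) → there (from (∈take⇔ m) i∈) })

∈drop⇔ : ∀ m {n} {X : Subset (m + n)} {j} → j ∈ drop m X ⇔ m ↑ʳ j ∈ X
∈drop⇔ zero                    = mk⇔ (λ j∈ → j∈) (λ j∈ → j∈)
∈drop⇔ (suc m) {X = x ∷ X} {j} = mk⇔ (there ∘ to (∈drop⇔ m))
                                    (λ { (there j∈) → from (∈drop⇔ m) j∈ })

x∈p⇒1≤∣p∣ : ∀ {n} {p : Subset n} {x} → x ∈ p → 1 ≤ ∣ p ∣
x∈p⇒1≤∣p∣ {x = x} x∈p = subst (_≤ _) (∣⁅x⁆∣≡1 x) (p⊆q⇒∣p∣≤∣q∣ (x∈p⇒⁅x⁆⊆p x∈p))

module Relabelling {N} (H : Subset N) (X : Subset (∣ ∁ H ∣ + ∣ H ∣)) where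

  pullback : Subset N
  pullback = tabulate (λ i → lookup X (Inverse.to (relabel H) i))

  joinBy-∈pullback⇔ : ∀ s → joinBy H s ∈ pullback ⇔ join _ _ s ∈ X
  joinBy-∈pullback⇔ s = subst (λ t → joinBy H s ∈ pullback ⇔ join _ _ t ∈ X) (splitBy-joinBy H s)
                              (⇔-sym ∈⇔lookup ⇔-∘ ∈tabulate⇔)

  joinBy-inj₁-∈⇔ : ∀ {a} → joinBy H (inj₁ a) ∈ pullback ⇔ a ∈ take ∣ ∁ H ∣ X
  joinBy-inj₁-∈⇔ {a} = ⇔-sym (∈take⇔ ∣ ∁ H ∣) ⇔-∘ joinBy-∈pullback⇔ (inj₁ a)

  joinBy-inj₂-∈⇔ : ∀ {b} → joinBy H (inj₂ b) ∈ pullback ⇔ b ∈ drop ∣ ∁ H ∣ X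
  joinBy-inj₂-∈⇔ {b} = ⇔-sym (∈drop⇔ ∣ ∁ H ∣) ⇔-∘ joinBy-∈pullback⇔ (inj₂ b)

  subsingleton-take⇔ : Subsingleton (take ∣ ∁ H ∣ X) ⇔ Subsingleton (pullback ∩ ∁ H)
  subsingleton-take⇔ = mk⇔ take⇒pullback pullback⇒take
    where
    take⇒pullback : Subsingleton (take ∣ ∁ H ∣ X) → Subsingleton (pullback ∩ ∁ H)
    take⇒pullback single y₁∈ y₂∈
      with y₁∈P , y₁∈∁H ← x∈p∩q⁻ pullback (∁ H) y₁∈
      with y₂∈P , y₂∈∁H ← x∈p∩q⁻ pullback (∁ H) y₂∈
      with a₁ , refl ← ∉⇒joinBy-inj₁ H (x∈∁p⇒x∉p y₁∈∁H)
      with a₂ , refl ← ∉⇒joinBy-inj₁ H (x∈∁p⇒x∉p y₂∈∁H)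
      = cong (joinBy H ∘ inj₁) (single (to joinBy-inj₁-∈⇔ y₁∈P) (to joinBy-inj₁-∈⇔ y₂∈P))
    pullback⇒take : Subsingleton (pullback ∩ ∁ H) → Subsingleton (take ∣ ∁ H ∣ X)
    pullback⇒take single {a₁} {a₂} a₁∈ a₂∈ =
      inj₁-injective (joinBy-injective H (single (outside-H a₁∈) (outside-H a₂∈)))
      where
      outside-H : ∀ {a} → a ∈ take ∣ ∁ H ∣ X → joinBy H (inj₁ a) ∈ pullback ∩ ∁ H
      outside-H {a} a∈ = x∈p∩q⁺ (from joinBy-inj₁-∈⇔ a∈ , x∉p⇒x∈∁p (joinBy-inj₁-∉ H a))

  ∃∉drop⇔ : (∃[ b ] b ∉ drop ∣ ∁ H ∣ X) ⇔ (∃[ h ] (h ∈ H × h ∉ pullback))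
  ∃∉drop⇔ = mk⇔ (λ (b , b∉) → joinBy H (inj₂ b) , joinBy-inj₂-∈ H b , b∉ ∘ to joinBy-inj₂-∈⇔)
                λ (h , h∈H , h∉) → let (b , eq) = ∈⇒joinBy-inj₂ H h∈H in
                  b , h∉ ∘ subst (_∈ pullback) eq ∘ from joinBy-inj₂-∈⇔

lemma2p9 : ∀ {N : ℕ} (M : Matroid N) → GF4-Representable M → (H : Subset N) → IsCircuitHyperplane M H → ¬ Connected M → ∃[ m ] ∃[ n ] (m ≥ 1 × n ≥ 1 × M ≅ DirectSumIndep {m} {n} (UniformIndep 1 m) (UniformIndep (n ∸ 1) n))
lemma2p9 M representable H (H-circuit , H-hyperplane) disconnected =
  ∣ ∁ H ∣ , ∣ H ∣ , x∈p⇒1≤∣p∣ (x∉p⇒x∈∁p (proj₂ ∃∉H)) , 1≤∣H∣ , ↔⇒⤖ (relabel H) , λ X →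
    let open Relabelling H X in
    ⇔-sym (indep⇔ disconnected)
      ⇔-∘ ((subsingleton-take⇔ ×-⇔ ∃∉drop⇔) ⇔-∘ (∣p∣≤1⇔subsingleton ×-⇔ ∣p∣≤n∸1⇔∃∉ 1≤∣H∣))
  where
  open MatroidProperties M
  open WithDecidableIndep (representable⇒indep? M representable)
  open CircuitHyperplane H-circuit H-hyperplane
  1≤∣H∣ : 1 ≤ ∣ H ∣
  1≤∣H∣ = x∈p⇒1≤∣p∣ (proj₂ H-nonempty)
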